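{- Let $n$ be a positive integer. Every hyperbinary expansion of $n$ of the form $2\,x_2\cdots x_h$ or of the form $1\,2\,x_3\cdots x_h$ is short, i.e. $h=\lfloor\log_2 n\rfloor$.
   Context: A hyperbinary expansion of a positive integer $n$ is a word $x_1\cdots x_h$ over the alphabet $\{0,1,2\}$ with $x_1\neq 0$ and $n=\sum_{i=1}^h x_i2^{h-i}$. Every hyperbinary expansion of $n$ has length $\lfloor\log_2 n\rfloor$ (called short) or $\lfloor\log_2 n\rfloor+1$ (called long). -}

module Defs where

open import Data.Nat using (ℕ; zero; suc; _+_; _*_)
open import Data.Fin using (Fin; toℕ)
open import Data.List using (List; []; _∷_; foldl)
open import Data.Product using (_×_)
open import Data.Empty using (⊥)
open import Relation.Binary.PropositionalEquality using (_≡_; _≢_)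

Digit : Set
Digit = Fin 3

-- value of x₁⋯x_h = Σ x_i 2^(h-i)  (Horner evaluation, most significant digit first)
val : List Digit → ℕ
val = foldl (λ acc d → 2 * acc + toℕ d) 0

LeadingNonZero : List Digit → Set
LeadingNonZero []      = ⊥
LeadingNonZero (d ∷ _) = toℕ d ≢ 0

IsHyperbinary : ℕ → List Digit → Set
IsHyperbinary n w = LeadingNonZero w × val w ≡ n

-- A word of length h over {0,1,2} has value at most 2 + 4 + ⋯ + 2^h = 2^(h+1) − 2, so
-- ⌊log₂ n⌋ ≤ h for every expansion, and the expansion is short exactly when n ≥ 2^h.
-- A leading 2 contributes 2 · 2^(h−1) = 2^h on its own, and a leading 12 contributes
-- 2^(h−1) + 2 · 2^(h−2) = 2^h.
module Submission where

open import Defs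
open import Data.Nat using (ℕ; NonZero; zero; suc; _+_; _*_; _^_; _∸_; _≤_; _<_; z≤n; s≤s; ⌊_/2⌋; ⌈_/2⌉)
open import Data.Nat.Properties
open import Data.Nat.Logarithm using (⌊log₂_⌋; ⌊log₂⌋-mono-≤; ⌊log₂⌊n/2⌋⌋≡⌊log₂n⌋∸1; ⌊log₂[2^n]⌋≡n)
open import Data.Nat.Solver using (module +-*-Solver)
open import Data.Fin using (zero; suc; toℕ)
open import Data.Fin.Properties using (toℕ≤pred[n])
open import Data.List using (List; []; _∷_; length; foldl)
open import Data.Sum using (_⊎_; inj₁; inj₂)
open import Data.Product using (∃; _,_)
open import Relation.Binary.PropositionalEquality using (_≡_; refl; sym; trans; cong; subst; module ≡-Reasoning)
open import Relation.Nullary using (contraposition)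

open +-*-Solver using (solve; _:=_; _:+_; _:*_; con)

2*m≤n⇒m≤⌊n/2⌋ : ∀ {m n} → 2 * m ≤ n → m ≤ ⌊ n /2⌋
2*m≤n⇒m≤⌊n/2⌋ {m} {n} 2m≤n = subst (_≤ ⌊ n /2⌋) ⌊2*m/2⌋≡m (⌊n/2⌋-mono 2m≤n)
  where
  ⌊2*m/2⌋≡m : ⌊ 2 * m /2⌋ ≡ m
  ⌊2*m/2⌋≡m = sym (trans (n≡⌊n+n/2⌋ m) (cong (λ k → ⌊ m + k /2⌋) (sym (+-identityʳ m))))

m≤⌊n/2⌋⇒2*m≤n : ∀ {m n} → m ≤ ⌊ n /2⌋ → 2 * m ≤ n
m≤⌊n/2⌋⇒2*m≤n {m} {n} m≤⌊n/2⌋ = begin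
  2 * m                 ≡⟨ cong (m +_) (+-identityʳ m) ⟩
  m + m                 ≤⟨ +-mono-≤ m≤⌊n/2⌋ (≤-trans m≤⌊n/2⌋ (⌊n/2⌋≤⌈n/2⌉ n)) ⟩
  ⌊ n /2⌋ + ⌈ n /2⌉     ≡⟨ ⌊n/2⌋+⌈n/2⌉≡n n ⟩
  n                     ∎
  where open ≤-Reasoning

n<2*m⇒⌊n/2⌋<m : ∀ {m n} → n < 2 * m → ⌊ n /2⌋ < m
n<2*m⇒⌊n/2⌋<m n<2m = ≰⇒> (contraposition m≤⌊n/2⌋⇒2*m≤n (<⇒≱ n<2m))

⌊log₂⌋-unique : ∀ h {n} → 2 ^ h ≤ n → n < 2 ^ suc h → ⌊log₂ n ⌋ ≡ h
⌊log₂⌋-unique zero    {suc zero}    _ _                 = refl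
⌊log₂⌋-unique zero    {suc (suc _)} _ (s≤s (s≤s ()))
⌊log₂⌋-unique (suc h) {n} 2^[1+h]≤n n<2^[2+h] = begin
  ⌊log₂ n ⌋              ≡⟨ sym (m+[n∸m]≡n 1≤⌊log₂n⌋) ⟩
  suc (⌊log₂ n ⌋ ∸ 1)    ≡⟨ cong suc (trans (sym (⌊log₂⌊n/2⌋⌋≡⌊log₂n⌋∸1 n)) ⌊log₂⌊n/2⌋⌋≡h) ⟩
  suc h                  ∎
  where
  open ≡-Reasoning
  ⌊log₂⌊n/2⌋⌋≡h : ⌊log₂ ⌊ n /2⌋ ⌋ ≡ h
  ⌊log₂⌊n/2⌋⌋≡h = ⌊log₂⌋-unique h (2*m≤n⇒m≤⌊n/2⌋ 2^[1+h]≤n) (n<2*m⇒⌊n/2⌋<m n<2^[2+h])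
  1+h≤⌊log₂n⌋ : suc h ≤ ⌊log₂ n ⌋
  1+h≤⌊log₂n⌋ = subst (_≤ ⌊log₂ n ⌋) (⌊log₂[2^n]⌋≡n (suc h)) (⌊log₂⌋-mono-≤ 2^[1+h]≤n)
  1≤⌊log₂n⌋ : 1 ≤ ⌊log₂ n ⌋
  1≤⌊log₂n⌋ = ≤-trans (s≤s z≤n) 1+h≤⌊log₂n⌋

horner : ℕ → Digit → ℕ
horner acc d = 2 * acc + toℕ d

foldl-horner : ∀ a ds → foldl horner a ds ≡ a * 2 ^ length ds + val ds
foldl-horner a []       = sym (trans (+-identityʳ (a * 1)) (*-identityʳ a))
foldl-horner a (d ∷ ds) = begin
  foldl horner (2 * a + toℕ d) ds            ≡⟨ foldl-horner (2 * a + toℕ d) ds ⟩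
  (2 * a + toℕ d) * 2 ^ k + val ds           ≡⟨ solve 4 (λ a d p v → (con 2 :* a :+ d) :* p :+ v
                                                                   := a :* (con 2 :* p) :+ (d :* p :+ v))
                                                        refl a (toℕ d) (2 ^ k) (val ds) ⟩
  a * 2 ^ suc k + (toℕ d * 2 ^ k + val ds)   ≡⟨ cong (a * 2 ^ suc k +_) (sym (foldl-horner (toℕ d) ds)) ⟩
  a * 2 ^ suc k + val (d ∷ ds)               ∎
  where
  open ≡-Reasoning
  k = length ds

val-∷ : ∀ d ds → val (d ∷ ds) ≡ toℕ d * 2 ^ length ds + val ds
val-∷ d ds = foldl-horner (toℕ d) ds

val+2≤2^[1+length] : ∀ ds → val ds + 2 ≤ 2 ^ suc (length ds)
val+2≤2^[1+length] []       = ≤-refl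
val+2≤2^[1+length] (d ∷ ds) = begin
  val (d ∷ ds) + 2                 ≡⟨ cong (_+ 2) (val-∷ d ds) ⟩
  toℕ d * 2 ^ k + val ds + 2       ≡⟨ +-assoc (toℕ d * 2 ^ k) (val ds) 2 ⟩
  toℕ d * 2 ^ k + (val ds + 2)     ≤⟨ +-mono-≤ (*-monoˡ-≤ (2 ^ k) (toℕ≤pred[n] d)) (val+2≤2^[1+length] ds) ⟩
  2 * 2 ^ k + 2 * 2 ^ k            ≡⟨ sym (*-distribʳ-+ (2 ^ k) 2 2) ⟩
  4 * 2 ^ k                        ≡⟨ *-assoc 2 2 (2 ^ k) ⟩
  2 ^ suc (suc k)                  ∎
  where
  open ≤-Reasoning
  k = length ds

val<2^[1+length] : ∀ ds → val ds < 2 ^ suc (length ds)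
val<2^[1+length] ds = ≤-trans (m<m+n (val ds) {2} (s≤s z≤n)) (val+2≤2^[1+length] ds)

⌊log₂val⌋≡length : ∀ ds → 2 ^ length ds ≤ val ds → ⌊log₂ val ds ⌋ ≡ length ds
⌊log₂val⌋≡length ds 2^length≤val = ⌊log₂⌋-unique (length ds) 2^length≤val (val<2^[1+length] ds)

2^length≤val[2∷ds] : ∀ ds → 2 ^ length (suc (suc zero) ∷ ds) ≤ val (suc (suc zero) ∷ ds)
2^length≤val[2∷ds] ds = subst (2 ^ suc (length ds) ≤_) (sym (val-∷ (suc (suc zero)) ds))
                              (m≤m+n (2 * 2 ^ length ds) (val ds))

2^length≤val⇒2^length≤val[1∷ds] : ∀ ds → 2 ^ length ds ≤ val ds →
                                   2 ^ length (suc zero ∷ ds) ≤ val (suc zero ∷ ds)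
2^length≤val⇒2^length≤val[1∷ds] ds 2^k≤val = begin
  2 * 2 ^ k               ≡⟨ cong (2 ^ k +_) (+-identityʳ (2 ^ k)) ⟩
  2 ^ k + 2 ^ k           ≤⟨ +-monoʳ-≤ (2 ^ k) 2^k≤val ⟩
  2 ^ k + val ds          ≡⟨ cong (_+ val ds) (sym (*-identityˡ (2 ^ k))) ⟩
  1 * 2 ^ k + val ds      ≡⟨ sym (val-∷ (suc zero) ds) ⟩
  val (suc zero ∷ ds)     ∎
  where
  open ≤-Reasoning
  k = length ds

lemma4p1 : (n : ℕ) → .{{_ : NonZero n}} → (w : List Digit) → IsHyperbinary n w →
    ((∃ λ rest → w ≡ suc (suc zero) ∷ rest) ⊎ (∃ λ rest → w ≡ suc zero ∷ suc (suc zero) ∷ rest)) →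
    length w ≡ ⌊log₂ n ⌋
lemma4p1 n w (_ , refl) (inj₁ (rest , refl)) =
  sym (⌊log₂val⌋≡length w (2^length≤val[2∷ds] rest))
lemma4p1 n w (_ , refl) (inj₂ (rest , refl)) =
  sym (⌊log₂val⌋≡length w (2^length≤val⇒2^length≤val[1∷ds] (suc (suc zero) ∷ rest) (2^length≤val[2∷ds] rest)))
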